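{- Let $m>2$ be an integer. For any $k,n\in\mathbb{Z}$, $$\left\lfloor\frac{2kn}{m}\right\rfloor+\left\lfloor\frac{n}{m}\right\rfloor+\left\lfloor\frac{k+1}{m}\right\rfloor\ \geqslant\ \left\lfloor\frac{k}{m}\right\rfloor+\left\lfloor\frac{2n}{m}\right\rfloor+\left\lfloor\frac{kn}{m}\right\rfloor+\left\lfloor\frac{(k-1)n+1}{m}\right\rfloor.$$ -}

module Defs where

open import Data.Nat using (ℕ; NonZero)
open import Data.Integer using (ℤ; _/ℕ_)

-- ⌊ a / m ⌋ for an integer a and a positive natural m.
-- stdlib's _/ℕ_ is Euclidean division with nonnegative remainder,
-- which for a positive divisor is exactly the floor.
⌊_/_⌋ : ℤ → (m : ℕ) → .{{NonZero m}} → ℤ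
⌊ a / m ⌋ = a /ℕ m

module Submission where

-- Write k = qₖ·m + a, n = qₙ·m + b and kn = qₚ·m + c with residues
-- a, b, c ∈ [0, m); then c ≡ ab (mod m).  Because ⌊(q·m + y)/m⌋ = q + ⌊y/m⌋, each
-- of the seven floors splits into an integer part and a carry that depends on the
-- residues only; the integer parts add up to qₖ + qₙ + 2qₚ on both sides, so the
-- theorem reduces to the carry inequality
--     ⌊2b/m⌋ + ⌊(1 + c - b)/m⌋  ≤  ⌊2c/m⌋ + ⌊(1 + a)/m⌋ .
-- Its only delicate case is 2c < m ≤ 2b with b ≤ c + 1: then m ≤ 2b ≤ 2c + 2 ≤ m + 1,
-- and doubling c ≡ ab gives 2c ≡ a·2b (mod m).  For m > 2 this excludes 2b = m,
-- so 2b = m + 1, whence 2c ≡ a (mod m), 2c ≤ a, and a + 1 ≥ m: the last carry is 1.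

open import Defs
open import Data.Nat using (ℕ; NonZero; _>_)
open import Relation.Binary.PropositionalEquality using (_≡_; cong; cong₂; trans)

module ResidueCarry (m : ℕ) .{{_ : NonZero m}} where

  open import Data.Nat
  open import Data.Nat.Properties
  open import Data.Nat.DivMod
  open import Data.Nat.Tactic.RingSolver using (solve-∀)
  open import Data.Empty using (⊥-elim)
  open import Data.Sum using (_⊎_; inj₁; inj₂)
  open import Relation.Binary.PropositionalEquality using (refl; sym)
  open import Relation.Nullary using (yes; no)
  open ≤-Reasoning

  *-%-absorb : ∀ t x → (t * (x % m)) % m ≡ (t * x) % m
  *-%-absorb t x = begin-equality
    (t * (x % m)) % m          ≡⟨ %-distribˡ-* t (x % m) m ⟩
    (t % m * (x % m % m)) % m  ≡⟨ cong (λ r → (t % m * r) % m) (m%n%n≡m%n x m) ⟩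
    (t % m * (x % m)) % m      ≡⟨ %-distribˡ-* t x m ⟨
    (t * x) % m                ∎

  -- The delicate configuration: if c ≡ ab (mod m), 2c < m ≤ 2b and b ≤ c + 1,
  -- then m > 2 forces 2b = m + 1, hence 2c ≡ a (mod m) and a + 1 ≥ m.
  half-residue-forces-carry : ∀ {a b c} → 2 < m → c ≡ (a * b) % m →
    2 * c < m → m ≤ 2 * b → b ≤ suc c → m ≤ suc a
  half-residue-forces-carry {a} {b} {c} m>2 c≡ab 2c<m m≤2b b≤1+c =
    by-cases (m≤n⇒m<n∨m≡n m≤2b)
    where
    2·ab≡a·2b : ∀ a b → 2 * (a * b) ≡ a * (2 * b)
    2·ab≡a·2b = solve-∀

    -- Doubling the congruence c ≡ ab; 2c needs no reduction as 2c < m.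
    2c≡a·2b : 2 * c ≡ (a * (2 * b)) % m
    2c≡a·2b = begin-equality
      2 * c                    ≡⟨ m<n⇒m%n≡m 2c<m ⟨
      (2 * c) % m              ≡⟨ cong (λ r → (2 * r) % m) c≡ab ⟩
      (2 * ((a * b) % m)) % m  ≡⟨ *-%-absorb 2 (a * b) ⟩
      (2 * (a * b)) % m        ≡⟨ cong (_% m) (2·ab≡a·2b a b) ⟩
      (a * (2 * b)) % m        ∎

    2b≤2+2c : 2 * b ≤ 2 + 2 * c
    2b≤2+2c = ≤-trans (*-monoʳ-≤ 2 b≤1+c) (≤-reflexive (*-suc 2 c))

    by-cases : m < 2 * b ⊎ m ≡ 2 * b → m ≤ suc a
    -- 2b = m would give 2c ≡ 0, so m = 2b ≤ 2, contradicting m > 2.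
    by-cases (inj₂ m≡2b) = ⊥-elim (<⇒≱ m>2 (begin
      m          ≡⟨ m≡2b ⟩
      2 * b      ≤⟨ 2b≤2+2c ⟩
      2 + 2 * c  ≡⟨ cong (2 +_) 2c≡0 ⟩
      2          ∎))
      where
      2c≡0 : 2 * c ≡ 0
      2c≡0 = trans 2c≡a·2b (trans (cong (λ t → (a * t) % m) (sym m≡2b)) (m*n%n≡0 a m))
    -- Otherwise 2b = m + 1, so 2c ≡ a(m + 1) ≡ a (mod m) and m + 1 ≤ 2c + 2 ≤ a + 2.
    by-cases (inj₁ m<2b) = s≤s⁻¹ (begin
      suc m      ≡⟨ 2b≡1+m ⟨
      2 * b      ≤⟨ 2b≤2+2c ⟩
      2 + 2 * c  ≤⟨ +-monoʳ-≤ 2 2c≤a ⟩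
      2 + a      ∎)
      where
      2b≡1+m : 2 * b ≡ suc m
      2b≡1+m = ≤-antisym (≤-trans 2b≤2+2c (s≤s 2c<m)) m<2b
      2c≤a : 2 * c ≤ a
      2c≤a = begin
        2 * c              ≡⟨ 2c≡a·2b ⟩
        (a * (2 * b)) % m  ≡⟨ cong (λ t → (a * t) % m) 2b≡1+m ⟩
        (a * suc m) % m    ≡⟨ cong (_% m) (*-suc a m) ⟩
        (a + a * m) % m    ≡⟨ [m+kn]%n≡m%n a a m ⟩
        a % m              ≤⟨ m%n≤m a m ⟩
        a                  ∎

  [2x]/m≤1 : ∀ {x} → x < m → (2 * x) / m ≤ 1
  [2x]/m≤1 x<m = s≤s⁻¹ (m<n*o⇒m/o<n (*-monoʳ-< 2 x<m))

  [1+c]/m≤[2c]/m : 1 < m → ∀ c → suc c / m ≤ (2 * c) / m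
  [1+c]/m≤[2c]/m 1<m zero    = ≤-reflexive (trans (m<n⇒m/n≡0 1<m) (sym (0/n≡0 m)))
  [1+c]/m≤[2c]/m 1<m (suc c) = /-monoˡ-≤ m (begin
    2 + c          ≤⟨ +-monoʳ-≤ 2 (m≤n*m c 2) ⟩
    2 + 2 * c      ≡⟨ *-suc 2 c ⟨
    2 * suc c      ∎)

  -- The carry inequality when the middle residue difference 1 + c - b is
  -- nonnegative (the negative case is immediate, see Floor.carry).
  carry-ℕ : ∀ {a b c} → 2 < m → b < m → c < m → c ≡ (a * b) % m → b ≤ suc c →
    (2 * b) / m + (suc c ∸ b) / m ≤ (2 * c) / m + suc a / m
  carry-ℕ {a} {b} {c} m>2 b<m c<m c≡ab b≤1+c with 2 * b <? m
  ... | yes 2b<m = begin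
    (2 * b) / m + (suc c ∸ b) / m  ≡⟨ cong (_+ (suc c ∸ b) / m) (m<n⇒m/n≡0 2b<m) ⟩
    (suc c ∸ b) / m                ≤⟨ /-monoˡ-≤ m (m∸n≤m (suc c) b) ⟩
    suc c / m                      ≤⟨ [1+c]/m≤[2c]/m (<⇒≤ m>2) c ⟩
    (2 * c) / m                    ≤⟨ m≤m+n _ _ ⟩
    (2 * c) / m + suc a / m        ∎
  ... | no 2b≮m = begin
    (2 * b) / m + (suc c ∸ b) / m  ≡⟨ cong ((2 * b) / m +_) (m<n⇒m/n≡0 1+c-b<m) ⟩
    (2 * b) / m + 0                ≡⟨ +-identityʳ _ ⟩
    (2 * b) / m                    ≤⟨ [2x]/m≤1 b<m ⟩
    1                              ≤⟨ some-carry ⟩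
    (2 * c) / m + suc a / m        ∎
    where
    m≤2b : m ≤ 2 * b
    m≤2b = ≮⇒≥ 2b≮m

    positive-half : ∀ {x} → m ≤ 2 * x → 0 < x
    positive-half {zero}  m≤0 = ⊥-elim (<-irrefl refl (<-≤-trans (>-nonZero⁻¹ m) m≤0))
    positive-half {suc x} _   = z<s

    1+c-b<m : suc c ∸ b < m
    1+c-b<m = ≤-<-trans (∸-monoʳ-≤ (suc c) (positive-half {b} m≤2b)) c<m

    some-carry : 1 ≤ (2 * c) / m + suc a / m
    some-carry with m ≤? 2 * c
    ... | yes m≤2c = ≤-trans (m≥n⇒m/n>0 m≤2c) (m≤m+n _ _)
    ... | no m≰2c  = ≤-trans (m≥n⇒m/n>0 m≤1+a) (m≤n+m _ _)
      where
      m≤1+a : m ≤ suc a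
      m≤1+a = half-residue-forces-carry m>2 c≡ab (≰⇒> m≰2c) m≤2b b≤1+c

module Floor (m : ℕ) .{{_ : NonZero m}} where

  import Data.Nat as ℕ
  import Data.Nat.Properties as ℕ
  open import Data.Integer hiding (NonZero)
  open import Data.Integer.Properties
  open import Data.Integer.DivMod using (a≡a%ℕn+[a/ℕn]*n; [n/ℕd]*d≤n; n<s[n/ℕd]*d)
  open import Data.Integer.Tactic.RingSolver using (solve-∀)
  open import Algebra.Properties.AbelianGroup +-0-abelianGroup using (∙-cancelˡ)
  open import Relation.Binary.PropositionalEquality using (sym; subst)
  open import Relation.Nullary using (yes; no)
  open ResidueCarry m using (carry-ℕ; [2x]/m≤1)
  open ≤-Reasoning

  M : ℤ
  M = + m

  quotient-remainder : ∀ x → x ≡ ⌊ x / m ⌋ * M + + (x %ℕ m)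
  quotient-remainder x = trans (a≡a%ℕn+[a/ℕn]*n x m) (+-comm (+ (x %ℕ m)) (⌊ x / m ⌋ * M))

  i<suc[j]⇒i≤j : ∀ {i j} → i < suc j → i ≤ j
  i<suc[j]⇒i≤j {i} {j} i<1+j = subst (i ≤_) (pred-suc j) (i<j⇒i≤pred[j] i<1+j)

  floor-lower : ∀ {q x} → q * M ≤ x → q ≤ ⌊ x / m ⌋
  floor-lower {q} {x} qm≤x =
    i<suc[j]⇒i≤j (*-cancelʳ-<-nonNeg M (≤-<-trans qm≤x (n<s[n/ℕd]*d x m)))

  floor-upper : ∀ {q x} → x < suc q * M → ⌊ x / m ⌋ ≤ q
  floor-upper {q} {x} x<[1+q]m =
    i<suc[j]⇒i≤j (*-cancelʳ-<-nonNeg M (≤-<-trans ([n/ℕd]*d≤n x m) x<[1+q]m))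

  floor-shift : ∀ q y → ⌊ q * M + y / m ⌋ ≡ q + ⌊ y / m ⌋
  floor-shift q y = ≤-antisym (floor-upper upper) (floor-lower lower)
    where
    f : ℤ
    f = ⌊ y / m ⌋

    collect : ∀ q f M → q * M + (1ℤ + f) * M ≡ (1ℤ + (q + f)) * M
    collect = solve-∀

    upper : q * M + y < suc (q + f) * M
    upper = begin-strict
      q * M + y          <⟨ +-monoʳ-< (q * M) (n<s[n/ℕd]*d y m) ⟩
      q * M + suc f * M  ≡⟨ collect q f M ⟩
      suc (q + f) * M    ∎

    lower : (q + f) * M ≤ q * M + y
    lower = begin
      (q + f) * M    ≡⟨ *-distribʳ-+ M q f ⟩
      q * M + f * M  ≤⟨ +-monoʳ-≤ (q * M) ([n/ℕd]*d≤n y m) ⟩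
      q * M + y      ∎

  remainder-shift : ∀ q y → (q * M + y) %ℕ m ≡ y %ℕ m
  remainder-shift q y = +-injective (∙-cancelˡ ((q + f) * M) _ _ (begin-equality
    (q + f) * M + + ((q * M + y) %ℕ m)
      ≡⟨ cong (λ t → t * M + + ((q * M + y) %ℕ m)) (floor-shift q y) ⟨
    ⌊ q * M + y / m ⌋ * M + + ((q * M + y) %ℕ m)
      ≡⟨ quotient-remainder (q * M + y) ⟨
    q * M + y
      ≡⟨ cong (_+_ (q * M)) (quotient-remainder y) ⟩
    q * M + (f * M + + (y %ℕ m))
      ≡⟨ regroup q f (+ (y %ℕ m)) M ⟩
    (q + f) * M + + (y %ℕ m) ∎))
    where
    f : ℤ
    f = ⌊ y / m ⌋

    regroup : ∀ q f r M → q * M + (f * M + r) ≡ (q + f) * M + r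
    regroup = solve-∀

  remainder-product : ∀ x y → (x * y) %ℕ m ≡ ((x %ℕ m) ℕ.* (y %ℕ m)) ℕ.% m
  remainder-product x y = trans (cong (_%ℕ m) x*y≡) (remainder-shift q (+ (a ℕ.* b)))
    where
    a b : ℕ
    a = x %ℕ m
    b = y %ℕ m
    q : ℤ
    q = ⌊ x / m ⌋ * ⌊ y / m ⌋ * M + ⌊ x / m ⌋ * + b + + a * ⌊ y / m ⌋

    expand : ∀ p a q b M → (p * M + a) * (q * M + b) ≡ (p * q * M + p * b + a * q) * M + a * b
    expand = solve-∀

    x*y≡ : x * y ≡ q * M + + (a ℕ.* b)
    x*y≡ = begin-equality
      x * y
        ≡⟨ cong₂ _*_ (quotient-remainder x) (quotient-remainder y) ⟩
      (⌊ x / m ⌋ * M + + a) * (⌊ y / m ⌋ * M + + b)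
        ≡⟨ expand ⌊ x / m ⌋ (+ a) ⌊ y / m ⌋ (+ b) M ⟩
      q * M + + a * + b
        ≡⟨ cong (_+_ (q * M)) (pos-* a b) ⟨
      q * M + + (a ℕ.* b) ∎

  floor-split : ∀ {x} q y → x ≡ q * M + y → ⌊ x / m ⌋ ≡ q + ⌊ y / m ⌋
  floor-split q y x≡qM+y = trans (cong (λ t → ⌊ t / m ⌋) x≡qM+y) (floor-shift q y)

  floor-double : ∀ x → ⌊ + 2 * x / m ⌋ ≡ + 2 * ⌊ x / m ⌋ + ⌊ + (2 ℕ.* (x %ℕ m)) / m ⌋
  floor-double x = floor-split (+ 2 * ⌊ x / m ⌋) _ (begin-equality
    + 2 * x                                ≡⟨ cong (+ 2 *_) (quotient-remainder x) ⟩
    + 2 * (⌊ x / m ⌋ * M + + r)            ≡⟨ distribute ⌊ x / m ⌋ (+ r) M ⟩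
    (+ 2 * ⌊ x / m ⌋) * M + + 2 * + r      ≡⟨ cong (_+_ ((+ 2 * ⌊ x / m ⌋) * M)) (pos-* 2 r) ⟨
    (+ 2 * ⌊ x / m ⌋) * M + + (2 ℕ.* r)    ∎)
    where
    r : ℕ
    r = x %ℕ m

    distribute : ∀ q r M → + 2 * (q * M + r) ≡ (+ 2 * q) * M + + 2 * r
    distribute = solve-∀

  floor-succ : ∀ x → ⌊ x + 1ℤ / m ⌋ ≡ ⌊ x / m ⌋ + ⌊ 1ℤ + + (x %ℕ m) / m ⌋
  floor-succ x = floor-split ⌊ x / m ⌋ _ (trans (cong (_+ 1ℤ) (quotient-remainder x))
                                                 (regroup ⌊ x / m ⌋ (+ (x %ℕ m)) M))
    where
    regroup : ∀ q r M → q * M + r + 1ℤ ≡ q * M + (1ℤ + r)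
    regroup = solve-∀

  floor-difference-succ : ∀ x y → ⌊ x - y + 1ℤ / m ⌋
    ≡ ⌊ x / m ⌋ - ⌊ y / m ⌋ + ⌊ 1ℤ + + (x %ℕ m) - + (y %ℕ m) / m ⌋
  floor-difference-succ x y = floor-split (⌊ x / m ⌋ - ⌊ y / m ⌋) _
    (trans (cong₂ (λ u v → u - v + 1ℤ) (quotient-remainder x) (quotient-remainder y))
           (regroup ⌊ x / m ⌋ (+ (x %ℕ m)) ⌊ y / m ⌋ (+ (y %ℕ m)) M))
    where
    regroup : ∀ p r q s M → p * M + r - (q * M + s) + 1ℤ ≡ (p - q) * M + (1ℤ + r - s)
    regroup = solve-∀

  carry : ∀ {a b c} → 2 ℕ.< m → b ℕ.< m → c ℕ.< m → c ≡ (a ℕ.* b) ℕ.% m →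
    ⌊ + (2 ℕ.* b) / m ⌋ + ⌊ 1ℤ + + c - + b / m ⌋ ≤ ⌊ + (2 ℕ.* c) / m ⌋ + ⌊ 1ℤ + + a / m ⌋
  carry {a} {b} {c} m>2 b<m c<m c≡ab with b ℕ.≤? ℕ.suc c
  ... | yes b≤1+c = begin
    ⌊ + (2 ℕ.* b) / m ⌋ + ⌊ 1ℤ + + c - + b / m ⌋
      ≡⟨ cong (λ t → ⌊ + (2 ℕ.* b) / m ⌋ + ⌊ t / m ⌋)
              (trans (m-n≡m⊖n (ℕ.suc c) b) (⊖-≥ b≤1+c)) ⟩
    + ((2 ℕ.* b) ℕ./ m ℕ.+ (ℕ.suc c ℕ.∸ b) ℕ./ m)
      ≤⟨ +≤+ (carry-ℕ m>2 b<m c<m c≡ab b≤1+c) ⟩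
    ⌊ + (2 ℕ.* c) / m ⌋ + ⌊ 1ℤ + + a / m ⌋ ∎
  -- If 1 + c < b the middle floor is at most -1, cancelling the carry ⌊2b/m⌋ ≤ 1.
  ... | no b≰1+c = begin
    ⌊ + (2 ℕ.* b) / m ⌋ + ⌊ 1ℤ + + c - + b / m ⌋
      ≤⟨ +-mono-≤ (+≤+ ([2x]/m≤1 b<m)) (floor-upper {q = -1ℤ} 1+c-b<0) ⟩
    1ℤ + -1ℤ
      ≤⟨ +≤+ ℕ.z≤n ⟩
    ⌊ + (2 ℕ.* c) / m ⌋ + ⌊ 1ℤ + + a / m ⌋ ∎
    where
    1+c<b : ℕ.suc c ℕ.< b
    1+c<b = ℕ.≰⇒> b≰1+c


    1+c-b<0 : 1ℤ + + c - + b < 0ℤ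
    1+c-b<0 = subst (_< 0ℤ) (sym (trans (m-n≡m⊖n (ℕ.suc c) b) (⊖-< 1+c<b)))
                     (neg-mono-< (+<+ (ℕ.m<n⇒0<n∸m 1+c<b)))

open import Data.Integer using (ℤ; _+_; _-_; _*_; _≥_; +_; 1ℤ; _%ℕ_)
import Data.Nat as ℕ
open import Data.Integer.DivMod using (n%ℕd<d)
open import Data.Integer.Properties using (*-assoc; +-monoʳ-≤; module ≤-Reasoning)
open import Data.Integer.Tactic.RingSolver using (solve-∀)

collect-right : ∀ qk qn qp u v →
  qk + (+ 2 * qn + u) + qp + (qp - qn + v) ≡ qk + qn + + 2 * qp + (u + v)
collect-right = solve-∀

collect-left : ∀ qk qn qp u v → + 2 * qp + u + qn + (qk + v) ≡ qk + qn + + 2 * qp + (u + v)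
collect-left = solve-∀

expand-pred : ∀ k n → (k - 1ℤ) * n + 1ℤ ≡ k * n - n + 1ℤ
expand-pred = solve-∀

theorem2p2 : (m : ℕ) .{{_ : NonZero m}} → m > 2 → (k n : ℤ) →
    ⌊ + 2 * k * n / m ⌋ + ⌊ n / m ⌋ + ⌊ k + 1ℤ / m ⌋
    ≥ ⌊ k / m ⌋ + ⌊ + 2 * n / m ⌋ + ⌊ k * n / m ⌋ + ⌊ (k - 1ℤ) * n + 1ℤ / m ⌋
theorem2p2 m m>2 k n = begin
    ⌊ k / m ⌋ + ⌊ + 2 * n / m ⌋ + ⌊ k * n / m ⌋ + ⌊ (k - 1ℤ) * n + 1ℤ / m ⌋
      ≡⟨ cong₂ (λ u v → qk + u + qp + v) (floor-double n)
               (trans (cong (λ t → ⌊ t / m ⌋) (expand-pred k n))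
                      (floor-difference-succ (k * n) n)) ⟩
    qk + (+ 2 * qn + carry-2b) + qp + (qp - qn + carry-1+c-b)
      ≡⟨ collect-right qk qn qp carry-2b carry-1+c-b ⟩
    common + (carry-2b + carry-1+c-b)
      ≤⟨ +-monoʳ-≤ common (carry m>2 (n%ℕd<d n m) (n%ℕd<d (k * n) m) (remainder-product k n)) ⟩
    common + (carry-2c + carry-1+a)
      ≡⟨ collect-left qk qn qp carry-2c carry-1+a ⟨
    + 2 * qp + carry-2c + qn + (qk + carry-1+a)
      ≡⟨ cong₂ (λ u v → u + qn + v)
               (trans (cong (λ t → ⌊ t / m ⌋) (*-assoc (+ 2) k n)) (floor-double (k * n)))
               (floor-succ k) ⟨
    ⌊ + 2 * k * n / m ⌋ + ⌊ n / m ⌋ + ⌊ k + 1ℤ / m ⌋ ∎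
  where
  open Floor m
  open ≤-Reasoning
  qk qn qp common carry-2b carry-1+c-b carry-2c carry-1+a : ℤ
  a b c : ℕ
  qk = ⌊ k / m ⌋
  qn = ⌊ n / m ⌋
  qp = ⌊ k * n / m ⌋
  a = k %ℕ m
  b = n %ℕ m
  c = (k * n) %ℕ m
  common = qk + qn + + 2 * qp
  carry-2b = ⌊ + (2 ℕ.* b) / m ⌋
  carry-1+c-b = ⌊ 1ℤ + + c - + b / m ⌋
  carry-2c = ⌊ + (2 ℕ.* c) / m ⌋
  carry-1+a = ⌊ 1ℤ + + a / m ⌋
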